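{- Let $G'$ be a finite directed multigraph on nodes $\{1,\dots,v'\}$ with $e'$ edges, no loops and no isolated nodes, let $f:\mathbf{N}\to\mathbf{N}$ satisfy $f(0)=e'$, $f(t)=0$ for $1\le t\le v'-1$, $f(t)\ge1$ for $t\ge v'$, let $F(t)=\sum_{i=0}^{t-1}f(i)$, and suppose $\sum_{s=1}^\infty \left(\frac{f(s)}{F(s)}\right)^2<\infty$. Run the process $\mathrm{MPA}_f(G')$ and for a node $u$ let $A_u(t):=\prod_{j=1}^{t-1}\left(1+\frac{f(j)}{2F(j)}\right)$ and $X_u(t):=d_u(t)/A_u(t)$. Then the martingale $X_u(t)$ is bounded in $\mathcal{L}_2$.
   Context: The process $\mathrm{MPA}_f(G')$: set $G(1)=\dots=G(v')=G'$; $G(t)$ has $F(t)$ edges. For $t\ge v'$, $G(t+1)$ is obtained from $G(t)$ (node set $\{1,\dots,t\}$) by adding a new node $t+1$ and $f(t)$ new directed edges starting at $t+1$, whose end-points are chosen independently with replacement from $\{1,\dots,t\}$, each equal to $u$ with probability $d_u(t)/(2F(t))$, where $d_u(t)$ is the degree of $u$ in $G(t)$ (counting multiplicities, ignoring direction). -}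

module Defs where

open import Data.Nat as ℕ using (ℕ; zero; suc; _≤_; _<_; _≤ᵇ_)
open import Data.Integer using (+_)
open import Data.Rational as ℚ using (ℚ; 0ℚ; 1ℚ; _+_; _*_; _/_; 1/_; ≢-nonZero)
open import Data.Rational.Properties using (_≟_)
open import Data.List using (_++_; List; []; _∷_; map; length; concatMap; upTo; foldr)
open import Data.Product using (_×_; _,_)
open import Data.Bool using (Bool; true; false; if_then_else_)
open import Relation.Nullary using (yes; no)

-- Directed multigraphs: a list of directed edges (a , b) = a → b.
-- The node set is implicit ({1,…,t} at time t).

Graph : Set
Graph = List (ℕ × ℕ)

-- degree of u: number of edge-endpoints equal to u (ignoring direction,
-- counting multiplicities; a loop would count twice)
deg : ℕ → Graph → ℕ
deg u [] = 0
deg u ((a , b) ∷ es) =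
  (if a ℕ.≡ᵇ u then 1 else 0) ℕ.+ (if b ℕ.≡ᵇ u then 1 else 0) ℕ.+ deg u es

-- n / d as a rational, with the convention n / 0 = 0 (never used in the
-- statement under its hypotheses, since F(t) ≥ 1 for t ≥ 1)
divℕ : ℕ → ℕ → ℚ
divℕ n zero    = 0ℚ
divℕ n (suc d) = (+ n) / suc d

-- p / q with the convention p / 0 = 0
_÷'_ : ℚ → ℚ → ℚ
p ÷' q with q ≟ 0ℚ
... | yes _ = 0ℚ
... | no q≢0 = p * (1/_ q {{≢-nonZero q≢0}})

sumBelow : (ℕ → ℕ) → ℕ → ℕ
sumBelow f zero    = 0
sumBelow f (suc t) = sumBelow f t ℕ.+ f t

F : (ℕ → ℕ) → ℕ → ℕ
F f = sumBelow f

sumℚ1 : (ℕ → ℚ) → ℕ → ℚ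
sumℚ1 g zero    = 0ℚ
sumℚ1 g (suc n) = sumℚ1 g n + g (suc n)

prodℚ1 : (ℕ → ℚ) → ℕ → ℚ
prodℚ1 g zero    = 1ℚ
prodℚ1 g (suc n) = prodℚ1 g n * g (suc n)

Dist : Set → Set
Dist A = List (ℚ × A)

pureD : {A : Set} → A → Dist A
pureD a = (1ℚ , a) ∷ []

bindD : {A B : Set} → Dist A → (A → Dist B) → Dist B
bindD d k = concatMap (λ { (p , a) → map (λ { (q , b) → (p * q , b) }) (k a) }) d

E : {A : Set} → Dist A → (A → ℚ) → ℚ
E d g = foldr (λ { (p , a) acc → p * g a + acc }) 0ℚ d

chooseEnd : (ℕ → ℕ) → ℕ → Graph → Dist ℕ
chooseEnd f t G = map (λ u → (divℕ (deg u G) (2 ℕ.* F f t) , u)) (map suc (upTo t))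

-- k independent endpoints (with replacement), all drawn using degrees of G(t)
draws : (ℕ → ℕ) → ℕ → Graph → ℕ → Dist (List ℕ)
draws f t G zero    = pureD []
draws f t G (suc k) =
  bindD (chooseEnd f t G) (λ w → map (λ { (q , ws) → (q , w ∷ ws) }) (draws f t G k))

step : (ℕ → ℕ) → ℕ → Graph → Dist Graph
step f t G = map (λ { (q , ws) → (q , map (λ w → (suc t , w)) ws ++ G) })
                 (draws f t G (f t))

-- distribution of G(t); G(1) = … = G(v') = G' (G(0) also set to G', unused)
MPA : (ℕ → ℕ) → (v' : ℕ) → Graph → ℕ → Dist Graph
MPA f v' G' zero    = pureD G'
MPA f v' G' (suc t) with suc t ≤ᵇ v'
... | true  = pureD G'
... | false = bindD (MPA f v' G' t) (step f t)

A : (ℕ → ℕ) → ℕ → ℚ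
A f t = prodℚ1 (λ j → 1ℚ + divℕ (f j) (2 ℕ.* F f j)) (t ℕ.∸ 1)

X : (ℕ → ℕ) → ℕ → ℕ → Graph → ℚ
X f u t G = ((+ deg u G) / 1) ÷' A f t

-- Write Ψ(d) = d² + d. Given G(t), the degree of an existing node u at time t + 1 is d + S,
-- where d = d_u(t) and S counts the hits of u among f(t) independent endpoints, each equal to
-- u with probability p ≤ d / 2F(t). Since E S = f p and E S² = f p + f (f − 1) p²,
--   E Ψ(d + S) = Ψ(d) + (2d + 1) f p + f p + f (f − 1) p² ≤ (1 + f(t) / 2F(t))² Ψ(d),
-- so Φ_u(t) = Ψ(d_u(t)) / A_u(t)² is a supermartingale as long as u already exists. A node
-- born at time t + 1 starts with degree f(t), hence E Φ_u(t) ≤ Ψ(d_u(v')) + Ψ(f(u − 1)) for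
-- every t, and X_u(t)² ≤ Φ_u(t).

module Submission where

open import Defs
open import Data.Nat using (ℕ; _<_; _≤_)
open import Data.Rational using (ℚ; _*_) renaming (_≤_ to _≤ℚ_)
open import Data.List using (length)
open import Data.List.Relation.Unary.All using (All)
open import Data.Product using (_×_; _,_; ∃-syntax)
open import Relation.Binary.PropositionalEquality using (_≡_; _≢_)

open import Data.Bool using (true; false; if_then_else_)
open import Data.Empty using (⊥-elim)
import Data.Integer as ℤ
import Data.Integer.Properties as ℤₚ
open import Data.List using (List; []; _∷_; _++_; map; upTo)
import Data.List.Properties as Listₚ
open import Data.List.Relation.Unary.All as All using ([]; _∷_)
import Data.List.Relation.Unary.All.Properties as Allₚ
open import Data.Nat as ℕ using (zero; suc; z≤n; s≤s)
open import Data.Nat.ListAction using (sum)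
import Data.Nat.ListAction.Properties as sumₚ
import Data.Nat.Properties as ℕₚ
open import Data.Product using (proj₁; proj₂)
open import Data.Rational as ℚ using (0ℚ; 1ℚ; _+_; _-_; _/_)
import Data.Rational.Properties as ℚₚ
open import Data.Rational.Solver using (module +-*-Solver)
import Data.Rational.Unnormalised as ℚᵘ
import Data.Rational.Unnormalised.Properties as ℚᵘₚ
open import Data.Sum using (inj₁; inj₂)
open import Data.Unit using (tt)
open import Relation.Binary.PropositionalEquality
  using (refl; sym; trans; cong; cong₂; subst; subst₂; module ≡-Reasoning)
open import Relation.Nullary using (yes; no)
import Algebra.Properties.CommutativeSemigroup ℕₚ.+-commutativeSemigroup as +-CS

open +-*-Solver

+-nonNeg : ∀ {p q} → 0ℚ ≤ℚ p → 0ℚ ≤ℚ q → 0ℚ ≤ℚ p + q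
+-nonNeg = ℚₚ.+-mono-≤

*-nonNeg : ∀ {p q} → 0ℚ ≤ℚ p → 0ℚ ≤ℚ q → 0ℚ ≤ℚ p * q
*-nonNeg {p} {q} p≥0 q≥0 = ℚₚ.nonNegative⁻¹ (p * q)
  {{ℚₚ.nonNeg*nonNeg⇒nonNeg p {{ℚ.nonNegative p≥0}} q {{ℚ.nonNegative q≥0}}}}

≤-by-nonNeg-gap : ∀ {p q} r → q ≡ p + r → 0ℚ ≤ℚ r → p ≤ℚ q
≤-by-nonNeg-gap {p} r q≡p+r r≥0 =
  subst₂ _≤ℚ_ (ℚₚ.+-identityʳ p) (sym q≡p+r) (ℚₚ.+-monoʳ-≤ p r≥0)

≤⇒0≤- : ∀ {p q} → p ≤ℚ q → 0ℚ ≤ℚ q - p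
≤⇒0≤- {p} {q} p≤q = subst (_≤ℚ q - p) (ℚₚ.+-inverseʳ p) (ℚₚ.+-monoˡ-≤ (ℚ.- p) p≤q)

1≤-* : ∀ {p q} → 1ℚ ≤ℚ p → 1ℚ ≤ℚ q → 1ℚ ≤ℚ p * q
1≤-* {p} {q} 1≤p 1≤q = ℚₚ.≤-trans 1≤q (subst (_≤ℚ p * q) (ℚₚ.*-identityˡ q)
  (ℚₚ.*-monoʳ-≤-nonNeg q {{ℚ.nonNegative (ℚₚ.≤-trans (ℚₚ.nonNegative⁻¹ 1ℚ) 1≤q)}} 1≤p))

≤1-* : ∀ {p q} → 0ℚ ≤ℚ p → p ≤ℚ 1ℚ → q ≤ℚ 1ℚ → p * q ≤ℚ 1ℚ
≤1-* {p} {q} p≥0 p≤1 q≤1 = ℚₚ.≤-trans (ℚₚ.*-monoˡ-≤-nonNeg p {{ℚ.nonNegative p≥0}} q≤1)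
  (subst (_≤ℚ 1ℚ) (sym (ℚₚ.*-identityʳ p)) p≤1)

≤-scaled-by-≤1 : ∀ {c p} → 0ℚ ≤ℚ c → c ≤ℚ 1ℚ → 0ℚ ≤ℚ p → c * p ≤ℚ p
≤-scaled-by-≤1 {c} {p} c≥0 c≤1 p≥0 =
  subst (c * p ≤ℚ_) (ℚₚ.*-identityˡ p) (ℚₚ.*-monoʳ-≤-nonNeg p {{ℚ.nonNegative p≥0}} c≤1)

-- Opaque, so that unification never unfolds the gcd normalisation inside _/_.
opaque
  fromℕ : ℕ → ℚ
  fromℕ n = ℤ.+ n / 1

  fromℕ-def : ∀ n → fromℕ n ≡ ℤ.+ n / 1
  fromℕ-def n = refl

  fromℕ-0 : fromℕ 0 ≡ 0ℚ
  fromℕ-0 = refl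

  fromℕ-1 : fromℕ 1 ≡ 1ℚ
  fromℕ-1 = refl

  toℚᵘ-fromℕ : ∀ n → ℚ.toℚᵘ (fromℕ n) ℚᵘ.≃ ℚᵘ.mkℚᵘ (ℤ.+ n) 0
  toℚᵘ-fromℕ n = ℚₚ.toℚᵘ-fromℚᵘ (ℚᵘ.mkℚᵘ (ℤ.+ n) 0)

  fromℕ-nonNeg : ∀ n → 0ℚ ≤ℚ fromℕ n
  fromℕ-nonNeg n = ℚₚ.nonNegative⁻¹ (fromℕ n) {{ℚₚ.normalize-nonNeg n 1}}

fromℕ-suc : ∀ n → fromℕ (suc n) ≡ 1ℚ + fromℕ n
fromℕ-suc n = ℚₚ.toℚᵘ-injective (ℚᵘₚ.≃-trans (toℚᵘ-fromℕ (suc n)) (ℚᵘₚ.≃-sym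
  (ℚᵘₚ.≃-trans (ℚₚ.toℚᵘ-homo-+ 1ℚ (fromℕ n))
  (ℚᵘₚ.≃-trans (ℚᵘₚ.+-congʳ (ℚᵘ.mkℚᵘ (ℤ.+ 1) 0) (toℚᵘ-fromℕ n))
               (ℚᵘ.*≡* (cong (λ z → (ℤ.+ 1 ℤ.+ z) ℤ.* ℤ.+ 1) (ℤₚ.*-identityʳ (ℤ.+ n))))))))

fromℕ-+ : ∀ m n → fromℕ (m ℕ.+ n) ≡ fromℕ m + fromℕ n
fromℕ-+ zero    n = sym (trans (cong (_+ fromℕ n) fromℕ-0) (ℚₚ.+-identityˡ (fromℕ n)))
fromℕ-+ (suc m) n = begin
  fromℕ (suc (m ℕ.+ n))      ≡⟨ fromℕ-suc (m ℕ.+ n) ⟩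
  1ℚ + fromℕ (m ℕ.+ n)       ≡⟨ cong (1ℚ +_) (fromℕ-+ m n) ⟩
  1ℚ + (fromℕ m + fromℕ n)   ≡⟨ ℚₚ.+-assoc 1ℚ (fromℕ m) (fromℕ n) ⟨
  (1ℚ + fromℕ m) + fromℕ n   ≡⟨ cong (_+ fromℕ n) (fromℕ-suc m) ⟨
  fromℕ (suc m) + fromℕ n    ∎
  where open ≡-Reasoning

fromℕ-* : ∀ m n → fromℕ (m ℕ.* n) ≡ fromℕ m * fromℕ n
fromℕ-* zero    n = trans fromℕ-0 (sym (trans (cong (_* fromℕ n) fromℕ-0) (ℚₚ.*-zeroˡ (fromℕ n))))
fromℕ-* (suc m) n = begin
  fromℕ (n ℕ.+ m ℕ.* n)          ≡⟨ fromℕ-+ n (m ℕ.* n) ⟩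
  fromℕ n + fromℕ (m ℕ.* n)      ≡⟨ cong (fromℕ n +_) (fromℕ-* m n) ⟩
  fromℕ n + fromℕ m * fromℕ n    ≡⟨ solve 2 (λ x y → y :+ x :* y := (con 1ℚ :+ x) :* y) refl (fromℕ m) (fromℕ n) ⟩
  (1ℚ + fromℕ m) * fromℕ n       ≡⟨ cong (_* fromℕ n) (fromℕ-suc m) ⟨
  fromℕ (suc m) * fromℕ n        ∎
  where open ≡-Reasoning

fromℕ-mono-≤ : ∀ {m n} → m ≤ n → fromℕ m ≤ℚ fromℕ n
fromℕ-mono-≤ {m} {n} m≤n = ≤-by-nonNeg-gap (fromℕ (n ℕ.∸ m))
  (trans (cong fromℕ (sym (ℕₚ.m+[n∸m]≡n m≤n))) (fromℕ-+ m (n ℕ.∸ m))) (fromℕ-nonNeg (n ℕ.∸ m))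

divℕ-nonNeg : ∀ n d → 0ℚ ≤ℚ divℕ n d
divℕ-nonNeg n zero    = ℚₚ.≤-refl
divℕ-nonNeg n (suc d) = ℚₚ.nonNegative⁻¹ (divℕ n (suc d)) {{ℚₚ.normalize-nonNeg n (suc d)}}

divℕ-*-fromℕ : ∀ n d → divℕ n (suc d) * fromℕ (suc d) ≡ fromℕ n
divℕ-*-fromℕ n d = ℚₚ.toℚᵘ-injective
  (ℚᵘₚ.≃-trans (ℚₚ.toℚᵘ-homo-* (divℕ n (suc d)) (fromℕ (suc d)))
  (ℚᵘₚ.≃-trans (ℚᵘₚ.*-cong (ℚₚ.toℚᵘ-fromℚᵘ (ℚᵘ.mkℚᵘ (ℤ.+ n) d)) (toℚᵘ-fromℕ (suc d)))
  (ℚᵘₚ.≃-trans (ℚᵘ.*≡* (ℤₚ.*-assoc (ℤ.+ n) (ℤ.+ suc d) (ℤ.+ 1))) (ℚᵘₚ.≃-sym (toℚᵘ-fromℕ n)))))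

fromℕ-*-divℕ-1 : ∀ d → 1 ≤ d → fromℕ d * divℕ 1 d ≡ 1ℚ
fromℕ-*-divℕ-1 (suc d) _ = trans (ℚₚ.*-comm (fromℕ (suc d)) (divℕ 1 (suc d))) (trans (divℕ-*-fromℕ 1 d) fromℕ-1)

divℕ≡fromℕ-*-divℕ-1 : ∀ n d → 1 ≤ d → divℕ n d ≡ fromℕ n * divℕ 1 d
divℕ≡fromℕ-*-divℕ-1 n (suc d) d≥1 = begin
  divℕ n (suc d)                                  ≡⟨ ℚₚ.*-identityʳ _ ⟨
  divℕ n (suc d) * 1ℚ                             ≡⟨ cong (divℕ n (suc d) *_) (fromℕ-*-divℕ-1 (suc d) d≥1) ⟨
  divℕ n (suc d) * (fromℕ (suc d) * divℕ 1 (suc d)) ≡⟨ ℚₚ.*-assoc (divℕ n (suc d)) _ _ ⟨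
  divℕ n (suc d) * fromℕ (suc d) * divℕ 1 (suc d) ≡⟨ cong (_* divℕ 1 (suc d)) (divℕ-*-fromℕ n d) ⟩
  fromℕ n * divℕ 1 (suc d)                        ∎
  where open ≡-Reasoning

Supported : {A : Set} → (A → Set) → Dist A → Set
Supported P = All (λ atom → 0ℚ ≤ℚ proj₁ atom × P (proj₂ atom))

IsProb : {A : Set} → Dist A → Set
IsProb d = E d (λ _ → 1ℚ) ≡ 1ℚ

module _ {A : Set} where

  E-++ : ∀ (d d′ : Dist A) g → E (d ++ d′) g ≡ E d g + E d′ g
  E-++ []            d′ g = sym (ℚₚ.+-identityˡ (E d′ g))
  E-++ ((p , a) ∷ d) d′ g =
    trans (cong (p * g a +_) (E-++ d d′ g)) (sym (ℚₚ.+-assoc (p * g a) (E d g) (E d′ g)))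

  E-cong : ∀ (d : Dist A) {g h} → (∀ a → g a ≡ h a) → E d g ≡ E d h
  E-cong []            g≡h = refl
  E-cong ((p , a) ∷ d) g≡h = cong₂ (λ x y → p * x + y) (g≡h a) (E-cong d g≡h)

  E-+ : ∀ (d : Dist A) g h → E d (λ a → g a + h a) ≡ E d g + E d h
  E-+ []            g h = sym (ℚₚ.+-identityʳ 0ℚ)
  E-+ ((p , a) ∷ d) g h = trans (cong (p * (g a + h a) +_) (E-+ d g h))
    (solve 5 (λ p x y u v → p :* (x :+ y) :+ (u :+ v) := (p :* x :+ u) :+ (p :* y :+ v))
      refl p (g a) (h a) (E d g) (E d h))

  E-*ˡ : ∀ (d : Dist A) c g → E d (λ a → c * g a) ≡ c * E d g
  E-*ˡ []            c g = sym (ℚₚ.*-zeroʳ c)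
  E-*ˡ ((p , a) ∷ d) c g = trans (cong (p * (c * g a) +_) (E-*ˡ d c g))
    (solve 4 (λ p c x u → p :* (c :* x) :+ c :* u := c :* (p :* x :+ u)) refl p c (g a) (E d g))

  E-const : ∀ (d : Dist A) → IsProb d → ∀ c → E d (λ _ → c) ≡ c
  E-const d prob c = begin
    E d (λ _ → c)         ≡⟨ E-cong d (λ _ → ℚₚ.*-identityʳ c) ⟨
    E d (λ _ → c * 1ℚ)    ≡⟨ E-*ˡ d c (λ _ → 1ℚ) ⟩
    c * E d (λ _ → 1ℚ)    ≡⟨ cong (c *_) prob ⟩
    c * 1ℚ                ≡⟨ ℚₚ.*-identityʳ c ⟩
    c                     ∎
    where open ≡-Reasoning

  E-pure : ∀ (a : A) g → E (pureD a) g ≡ g a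
  E-pure a g = trans (ℚₚ.+-identityʳ (1ℚ * g a)) (ℚₚ.*-identityˡ (g a))

  E-mono : ∀ {P} (d : Dist A) {g h} → Supported P d → (∀ a → P a → g a ≤ℚ h a) → E d g ≤ℚ E d h
  E-mono []            []                  g≤h = ℚₚ.≤-refl
  E-mono ((p , a) ∷ d) ((p≥0 , Pa) ∷ supp) g≤h =
    ℚₚ.+-mono-≤ (ℚₚ.*-monoˡ-≤-nonNeg p {{ℚ.nonNegative p≥0}} (g≤h a Pa)) (E-mono d supp g≤h)

  E-congOn : ∀ {P} (d : Dist A) {g h} → Supported P d → (∀ a → P a → g a ≡ h a) → E d g ≡ E d h
  E-congOn d supp g≡h = ℚₚ.≤-antisym (E-mono d supp (λ a Pa → ℚₚ.≤-reflexive (g≡h a Pa)))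
                                      (E-mono d supp (λ a Pa → ℚₚ.≤-reflexive (sym (g≡h a Pa))))

  E-nonNeg : ∀ {P} (d : Dist A) {g} → Supported P d → (∀ a → 0ℚ ≤ℚ g a) → 0ℚ ≤ℚ E d g
  E-nonNeg []            []                 g≥0 = ℚₚ.≤-refl
  E-nonNeg ((p , a) ∷ d) ((p≥0 , _) ∷ supp) g≥0 = +-nonNeg (*-nonNeg p≥0 (g≥0 a)) (E-nonNeg d supp g≥0)

module _ {A B : Set} where

  E-map : ∀ (h : ℚ × A → ℚ × B) (h′ : A → B) → (∀ p a → h (p , a) ≡ (p , h′ a)) →
          ∀ (d : Dist A) g → E (map h d) g ≡ E d (λ a → g (h′ a))
  E-map h h′ h≗ []            g = refl
  E-map h h′ h≗ ((p , a) ∷ d) g rewrite h≗ p a = cong (p * g (h′ a) +_) (E-map h h′ h≗ d g)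

  E-bind : ∀ (d : Dist A) (k : A → Dist B) g → E (bindD d k) g ≡ E d (λ a → E (k a) g)
  E-bind []            k g = refl
  E-bind ((p , a) ∷ d) k g = trans (E-++ (map _ (k a)) (bindD d k) g)
                                   (cong₂ _+_ (E-scaled (k a)) (E-bind d k g))
    where
    E-scaled : ∀ (d′ : Dist B) → E (map (λ { (q , b) → (p * q , b) }) d′) g ≡ p * E d′ g
    E-scaled []            = sym (ℚₚ.*-zeroʳ p)
    E-scaled ((q , b) ∷ d′) = trans (cong (p * q * g b +_) (E-scaled d′))
      (solve 4 (λ p q x u → p :* q :* x :+ p :* u := p :* (q :* x :+ u)) refl p q (g b) (E d′ g))

  Supported-map : ∀ {P Q} (h : ℚ × A → ℚ × B) (h′ : A → B) → (∀ p a → h (p , a) ≡ (p , h′ a)) →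
                  (∀ a → P a → Q (h′ a)) → ∀ d → Supported P d → Supported Q (map h d)
  Supported-map h h′ h≗ P⇒Q []            []                  = []
  Supported-map h h′ h≗ P⇒Q ((p , a) ∷ d) ((p≥0 , Pa) ∷ supp) rewrite h≗ p a =
    (p≥0 , P⇒Q a Pa) ∷ Supported-map h h′ h≗ P⇒Q d supp

  Supported-bind : ∀ {P Q} (d : Dist A) (k : A → Dist B) →
                   Supported P d → (∀ a → P a → Supported Q (k a)) → Supported Q (bindD d k)
  Supported-bind []            k []                  supp-k = []
  Supported-bind ((p , a) ∷ d) k ((p≥0 , Pa) ∷ supp) supp-k =
    Allₚ.++⁺ (scaled (k a) (supp-k a Pa)) (Supported-bind d k supp supp-k)
    where
    scaled : ∀ d′ → Supported _ d′ → Supported _ (map (λ { (q , b) → (p * q , b) }) d′)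
    scaled []             []                  = []
    scaled ((q , b) ∷ d′) ((q≥0 , Qb) ∷ supp′) = (*-nonNeg p≥0 q≥0 , Qb) ∷ scaled d′ supp′

module _ {A : Set} (d : Dist A) (prob : IsProb d) where

  E-const-+ : ∀ c g → E d (λ a → c + g a) ≡ c + E d g
  E-const-+ c g = trans (E-+ d (λ _ → c) g) (cong (_+ E d g) (E-const d prob c))

  E-square-shift : ∀ x g →
    E d (λ a → (x + g a) * (x + g a)) ≡ x * x + (x + x) * E d g + E d (λ a → g a * g a)
  E-square-shift x g = begin
    E d (λ a → (x + g a) * (x + g a))
      ≡⟨ E-cong d (λ a → solve 2 (λ x y → (x :+ y) :* (x :+ y) := x :* x :+ ((x :+ x) :* y :+ y :* y))
                          refl x (g a)) ⟩
    E d (λ a → x * x + ((x + x) * g a + g a * g a))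
      ≡⟨ E-const-+ (x * x) _ ⟩
    x * x + E d (λ a → (x + x) * g a + g a * g a)
      ≡⟨ cong (x * x +_) (trans (E-+ d _ _) (cong (_+ E d (λ a → g a * g a)) (E-*ˡ d (x + x) g))) ⟩
    x * x + ((x + x) * E d g + E d (λ a → g a * g a))
      ≡⟨ ℚₚ.+-assoc (x * x) _ _ ⟨
    x * x + (x + x) * E d g + E d (λ a → g a * g a) ∎
    where open ≡-Reasoning

-- deg u ((a , b) ∷ G) is definitionally δ a u ℕ.+ δ b u ℕ.+ deg u G.
δ : ℕ → ℕ → ℕ
δ a u = if a ℕ.≡ᵇ u then 1 else 0

δ-≡ : ∀ {a u} → a ≡ u → δ a u ≡ 1
δ-≡ {a} {u} a≡u with a ℕ.≡ᵇ u | ℕₚ.≡⇒≡ᵇ a u a≡u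
... | true | _ = refl

δ-≢ : ∀ {a u} → a ≢ u → δ a u ≡ 0
δ-≢ {a} {u} a≢u with a ℕ.≡ᵇ u | ℕₚ.≡ᵇ⇒≡ a u
... | true  | a≡u = ⊥-elim (a≢u (a≡u tt))
... | false | _   = refl

δ-comm : ∀ a u → δ a u ≡ δ u a
δ-comm a u with a ℕₚ.≟ u
... | yes a≡u = trans (δ-≡ a≡u) (sym (δ-≡ (sym a≡u)))
... | no  a≢u = trans (δ-≢ a≢u) (sym (δ-≢ (λ u≡a → a≢u (sym u≡a))))

δ-*-δ : ∀ a u → δ a u ℕ.* δ a u ≡ δ a u
δ-*-δ a u with a ℕₚ.≟ u
... | yes a≡u rewrite δ-≡ a≡u = refl
... | no  a≢u rewrite δ-≢ a≢u = refl

range : ℕ → List ℕ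
range t = map suc (upTo t)

sum-map-+ : ∀ (g h : ℕ → ℕ) l → sum (map (λ v → g v ℕ.+ h v) l) ≡ sum (map g l) ℕ.+ sum (map h l)
sum-map-+ g h []      = refl
sum-map-+ g h (v ∷ l) =
  trans (cong (g v ℕ.+ h v ℕ.+_) (sum-map-+ g h l)) (+-CS.interchange (g v) (h v) _ _)

sum-range-suc : ∀ (g : ℕ → ℕ) t → sum (map g (range (suc t))) ≡ sum (map g (range t)) ℕ.+ g (suc t)
sum-range-suc g t = begin
  sum (map g (range (suc t)))
    ≡⟨ cong (λ l → sum (map g (map suc l))) (Listₚ.upTo-∷ʳ t) ⟨
  sum (map g (map suc (upTo t ++ t ∷ [])))
    ≡⟨ cong (λ l → sum (map g l)) (Listₚ.map-++ suc (upTo t) (t ∷ [])) ⟩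
  sum (map g (range t ++ suc t ∷ []))
    ≡⟨ cong sum (Listₚ.map-++ g (range t) (suc t ∷ [])) ⟩
  sum (map g (range t) ++ g (suc t) ∷ [])
    ≡⟨ sumₚ.sum-++ (map g (range t)) (g (suc t) ∷ []) ⟩
  sum (map g (range t)) ℕ.+ (g (suc t) ℕ.+ 0)
    ≡⟨ cong (sum (map g (range t)) ℕ.+_) (ℕₚ.+-identityʳ (g (suc t))) ⟩
  sum (map g (range t)) ℕ.+ g (suc t) ∎
  where open ≡-Reasoning

module _ (h : ℕ → ℕ) (u : ℕ) where

  sum-range-δ-above : ∀ t → t < u → sum (map (λ v → h v ℕ.* δ v u) (range t)) ≡ 0
  sum-range-δ-above zero    _   = refl
  sum-range-δ-above (suc t) t<u
    rewrite sum-range-suc (λ v → h v ℕ.* δ v u) t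
          | sum-range-δ-above t (ℕₚ.<-trans (ℕₚ.n<1+n t) t<u)
          | δ-≢ (ℕₚ.<⇒≢ t<u) = ℕₚ.*-zeroʳ (h (suc t))

  sum-range-δ-within : ∀ t → 1 ≤ u → u ≤ t → sum (map (λ v → h v ℕ.* δ v u) (range t)) ≡ h u
  sum-range-δ-within zero    1≤u u≤0 = ⊥-elim (ℕₚ.<-irrefl refl (ℕₚ.≤-trans 1≤u u≤0))
  sum-range-δ-within (suc t) 1≤u u≤t+1 rewrite sum-range-suc (λ v → h v ℕ.* δ v u) t with suc t ℕₚ.≟ u
  ... | yes refl rewrite sum-range-δ-above t ℕₚ.≤-refl | δ-≡ (refl {x = u}) = ℕₚ.*-identityʳ (h u)
  ... | no t+1≢u rewrite δ-≢ t+1≢u | ℕₚ.*-zeroʳ (h (suc t)) =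
    trans (ℕₚ.+-identityʳ _) (sum-range-δ-within t 1≤u u≤t)
    where
    u≤t : u ≤ t
    u≤t = ℕₚ.≤-pred (ℕₚ.≤∧≢⇒< u≤t+1 (λ u≡t+1 → t+1≢u (sym u≡t+1)))

  sum-range-δ-≤ : ∀ t → sum (map (λ v → h v ℕ.* δ v u) (range t)) ≤ h u
  sum-range-δ-≤ zero = z≤n
  sum-range-δ-≤ (suc t) rewrite sum-range-suc (λ v → h v ℕ.* δ v u) t with suc t ℕₚ.≟ u
  ... | yes refl rewrite sum-range-δ-above t ℕₚ.≤-refl | δ-≡ (refl {x = u}) =
    ℕₚ.≤-reflexive (ℕₚ.*-identityʳ (h u))
  ... | no t+1≢u rewrite δ-≢ t+1≢u | ℕₚ.*-zeroʳ (h (suc t)) =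
    subst (_≤ h u) (sym (ℕₚ.+-identityʳ _)) (sum-range-δ-≤ t)

InRange : ℕ → ℕ → Set
InRange t a = 1 ≤ a × a ≤ t

EdgesWithin : ℕ → Graph → Set
EdgesWithin t = All (λ e → InRange t (proj₁ e) × InRange t (proj₂ e))

EdgesWithin-weaken : ∀ {t t′} G → t ≤ t′ → EdgesWithin t G → EdgesWithin t′ G
EdgesWithin-weaken G t≤t′ = All.map λ { ((1≤a , a≤t) , (1≤b , b≤t)) →
  (1≤a , ℕₚ.≤-trans a≤t t≤t′) , (1≤b , ℕₚ.≤-trans b≤t t≤t′) }

sum-range-δ-endpoint : ∀ {a t} → InRange t a → sum (map (δ a) (range t)) ≡ 1
sum-range-δ-endpoint {a} {t} (1≤a , a≤t) =
  trans (cong sum (Listₚ.map-cong (λ v → trans (δ-comm a v) (sym (ℕₚ.*-identityˡ (δ v a)))) (range t)))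
        (sum-range-δ-within (λ _ → 1) a t 1≤a a≤t)

sum-deg : ∀ t G → EdgesWithin t G → sum (map (λ v → deg v G) (range t)) ≡ 2 ℕ.* length G
sum-deg t []            []                  = sum-zero (range t)
  where
  sum-zero : ∀ l → sum (map (λ _ → 0) l) ≡ 0
  sum-zero []      = refl
  sum-zero (_ ∷ l) = sum-zero l
sum-deg t ((a , b) ∷ G) ((a∈ , b∈) ∷ edges) = begin
  sum (map (λ v → δ a v ℕ.+ δ b v ℕ.+ deg v G) (range t))
    ≡⟨ sum-map-+ (λ v → δ a v ℕ.+ δ b v) (λ v → deg v G) (range t) ⟩
  sum (map (λ v → δ a v ℕ.+ δ b v) (range t)) ℕ.+ sum (map (λ v → deg v G) (range t))
    ≡⟨ cong₂ ℕ._+_ (sum-map-+ (δ a) (δ b) (range t)) (sum-deg t G edges) ⟩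
  sum (map (δ a) (range t)) ℕ.+ sum (map (δ b) (range t)) ℕ.+ 2 ℕ.* length G
    ≡⟨ cong₂ (λ x y → x ℕ.+ y ℕ.+ 2 ℕ.* length G) (sum-range-δ-endpoint a∈) (sum-range-δ-endpoint b∈) ⟩
  2 ℕ.+ 2 ℕ.* length G
    ≡⟨ ℕₚ.*-suc 2 (length G) ⟨
  2 ℕ.* suc (length G) ∎
  where open ≡-Reasoning

deg-above : ∀ {t v} G → EdgesWithin t G → t < v → deg v G ≡ 0
deg-above []            []                                     t<v = refl
deg-above ((a , b) ∷ G) (((_ , a≤t) , (_ , b≤t)) ∷ edges) t<v
  rewrite δ-≢ (ℕₚ.<⇒≢ (ℕₚ.≤-<-trans a≤t t<v)) | δ-≢ (ℕₚ.<⇒≢ (ℕₚ.≤-<-trans b≤t t<v)) =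
  deg-above G edges t<v

deg-++ : ∀ u G H → deg u (G ++ H) ≡ deg u G ℕ.+ deg u H
deg-++ u []            H = refl
deg-++ u ((a , b) ∷ G) H =
  trans (cong (δ a u ℕ.+ δ b u ℕ.+_) (deg-++ u G H)) (sym (ℕₚ.+-assoc (δ a u ℕ.+ δ b u) _ _))

star : ℕ → List ℕ → Graph
star c = map (c ,_)

length-star : ∀ c ws → length (star c ws) ≡ length ws
length-star c []       = refl
length-star c (_ ∷ ws) = cong suc (length-star c ws)

deg-star : ∀ u c ws → deg u (star c ws) ≡ sum (map (λ w → δ c u ℕ.+ δ w u) ws)
deg-star u c []       = refl
deg-star u c (w ∷ ws) = cong (δ c u ℕ.+ δ w u ℕ.+_) (deg-star u c ws)

deg-add-star : ∀ u c ws G →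
  deg u (star c ws ++ G) ≡ deg u G ℕ.+ sum (map (λ w → δ c u ℕ.+ δ w u) ws)
deg-add-star u c ws G = begin
  deg u (star c ws ++ G)                           ≡⟨ deg-++ u (star c ws) G ⟩
  deg u (star c ws) ℕ.+ deg u G                    ≡⟨ cong (ℕ._+ deg u G) (deg-star u c ws) ⟩
  sum (map (λ w → δ c u ℕ.+ δ w u) ws) ℕ.+ deg u G              ≡⟨ ℕₚ.+-comm _ (deg u G) ⟩
  deg u G ℕ.+ sum (map (λ w → δ c u ℕ.+ δ w u) ws)              ∎
  where open ≡-Reasoning

sum-star-newborn : ∀ {t} ws → All (InRange t) ws →
  sum (map (λ w → δ (suc t) (suc t) ℕ.+ δ w (suc t)) ws) ≡ length ws
sum-star-newborn {t} []       []                  = refl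
sum-star-newborn {t} (w ∷ ws) ((_ , w≤t) ∷ ws∈) =
  cong₂ ℕ._+_ (cong₂ ℕ._+_ (δ-≡ (refl {x = suc t})) (δ-≢ (ℕₚ.<⇒≢ (s≤s w≤t)))) (sum-star-newborn ws ws∈)

Ψ : ℚ → ℚ
Ψ y = y * y + y

Ψ-nonNeg : ∀ {y} → 0ℚ ≤ℚ y → 0ℚ ≤ℚ Ψ y
Ψ-nonNeg y≥0 = +-nonNeg (*-nonNeg y≥0 y≥0) y≥0

Ψ-growth-≤ : ∀ {x s k p} → 0ℚ ≤ℚ x → 0ℚ ≤ℚ s → 0ℚ ≤ℚ k → 0ℚ ≤ℚ p → k * p ≤ℚ s * x →
  Ψ x + (x + x + 1ℚ) * (k * p) + (k * p + k * (k - 1ℚ) * p * p) ≤ℚ (1ℚ + s) * (1ℚ + s) * Ψ x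
Ψ-growth-≤ {x} {s} {k} {p} x≥0 s≥0 k≥0 p≥0 kp≤sx = ≤-by-nonNeg-gap
  ((s * x - k * p) * (x + x + 1ℚ + 1ℚ) + (s * x - k * p) * (s * x + k * p) + s * s * x + k * p * p)
  (solve 4 (λ x s k p → (con 1ℚ :+ s) :* (con 1ℚ :+ s) :* (x :* x :+ x)
              := x :* x :+ x :+ (x :+ x :+ con 1ℚ) :* (k :* p) :+ (k :* p :+ k :* (k :- con 1ℚ) :* p :* p)
                 :+ ((s :* x :- k :* p) :* (x :+ x :+ con 1ℚ :+ con 1ℚ) :+ (s :* x :- k :* p) :* (s :* x :+ k :* p)
                     :+ s :* s :* x :+ k :* p :* p))
     refl x s k p)
  (+-nonNeg (+-nonNeg (+-nonNeg (*-nonNeg gap≥0 (+-nonNeg (+-nonNeg (+-nonNeg x≥0 x≥0) 1≥0) 1≥0))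
                                (*-nonNeg gap≥0 (+-nonNeg (*-nonNeg s≥0 x≥0) (*-nonNeg k≥0 p≥0))))
                      (*-nonNeg (*-nonNeg s≥0 s≥0) x≥0))
            (*-nonNeg (*-nonNeg k≥0 p≥0) p≥0))
  where
  gap≥0 = ≤⇒0≤- kp≤sx
  1≥0 = ℚₚ.nonNegative⁻¹ 1ℚ

E-weighted-fromℕ : ∀ (w h : ℕ → ℕ) D → 1 ≤ D → ∀ l →
  E (map (λ v → (divℕ (w v) D , v)) l) (λ v → fromℕ (h v))
    ≡ fromℕ (sum (map (λ v → w v ℕ.* h v) l)) * divℕ 1 D
E-weighted-fromℕ w h D D≥1 []      = sym (trans (cong (_* divℕ 1 D) fromℕ-0) (ℚₚ.*-zeroˡ (divℕ 1 D)))
E-weighted-fromℕ w h D D≥1 (v ∷ l) = begin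
  divℕ (w v) D * fromℕ (h v) + E (map (λ v → (divℕ (w v) D , v)) l) (λ v → fromℕ (h v))
    ≡⟨ cong₂ (λ x y → x * fromℕ (h v) + y) (divℕ≡fromℕ-*-divℕ-1 (w v) D D≥1) (E-weighted-fromℕ w h D D≥1 l) ⟩
  fromℕ (w v) * r * fromℕ (h v) + fromℕ Σ * r
    ≡⟨ solve 4 (λ a r b c → a :* r :* b :+ c :* r := (a :* b :+ c) :* r) refl (fromℕ (w v)) r (fromℕ (h v)) (fromℕ Σ) ⟩
  (fromℕ (w v) * fromℕ (h v) + fromℕ Σ) * r
    ≡⟨ cong (λ x → (x + fromℕ Σ) * r) (fromℕ-* (w v) (h v)) ⟨
  (fromℕ (w v ℕ.* h v) + fromℕ Σ) * r
    ≡⟨ cong (_* r) (fromℕ-+ (w v ℕ.* h v) Σ) ⟨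
  fromℕ (w v ℕ.* h v ℕ.+ Σ) * r ∎
  where
  open ≡-Reasoning
  r = divℕ 1 D
  Σ = sum (map (λ v → w v ℕ.* h v) l)

module _ (f : ℕ → ℕ) (t : ℕ) (G : Graph) where

  private
    D : Dist ℕ
    D = chooseEnd f t G

  chooseEnd-supported : Supported (InRange t) D
  chooseEnd-supported = Allₚ.map⁺ (Allₚ.map⁺ (Allₚ.applyUpTo⁺₁ (λ i → i) t
    (λ {i} i<t → divℕ-nonNeg (deg (suc i) G) (2 ℕ.* F f t) , (s≤s z≤n , i<t))))

  E-chooseEnd : 1 ≤ F f t → ∀ h →
    E D (λ v → fromℕ (h v)) ≡ fromℕ (sum (map (λ v → deg v G ℕ.* h v) (range t))) * divℕ 1 (2 ℕ.* F f t)
  E-chooseEnd F≥1 h = E-weighted-fromℕ (λ v → deg v G) h (2 ℕ.* F f t) (ℕₚ.≤-trans F≥1 (ℕₚ.m≤m+n _ _)) (range t)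

  chooseEnd-prob : 1 ≤ F f t → EdgesWithin t G → length G ≡ F f t → IsProb D
  chooseEnd-prob F≥1 edges |G|≡F = begin
    E D (λ _ → 1ℚ)
      ≡⟨ E-cong D (λ _ → fromℕ-1) ⟨
    E D (λ _ → fromℕ 1)
      ≡⟨ E-chooseEnd F≥1 (λ _ → 1) ⟩
    fromℕ (sum (map (λ v → deg v G ℕ.* 1) (range t))) * divℕ 1 (2 ℕ.* F f t)
      ≡⟨ cong (λ n → fromℕ n * divℕ 1 (2 ℕ.* F f t)) total-degree ⟩
    fromℕ (2 ℕ.* F f t) * divℕ 1 (2 ℕ.* F f t)
      ≡⟨ fromℕ-*-divℕ-1 (2 ℕ.* F f t) (ℕₚ.≤-trans F≥1 (ℕₚ.m≤m+n _ _)) ⟩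
    1ℚ ∎
    where
    open ≡-Reasoning
    total-degree : sum (map (λ v → deg v G ℕ.* 1) (range t)) ≡ 2 ℕ.* F f t
    total-degree = trans (cong sum (Listₚ.map-cong (λ v → ℕₚ.*-identityʳ (deg v G)) (range t)))
                         (trans (sum-deg t G edges) (cong (2 ℕ.*_) |G|≡F))

  draws-supported : ∀ k → Supported (λ ws → All (InRange t) ws × length ws ≡ k) (draws f t G k)
  draws-supported zero    = (ℚₚ.nonNegative⁻¹ 1ℚ , ([] , refl)) ∷ []
  draws-supported (suc k) = Supported-bind D _ chooseEnd-supported λ w w∈ →
    Supported-map _ (w ∷_) (λ _ _ → refl) (λ { ws (ws∈ , |ws|≡k) → (w∈ ∷ ws∈) , cong suc |ws|≡k })
                  (draws f t G k) (draws-supported k)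

  E-draws-suc : ∀ k g → E (draws f t G (suc k)) g ≡ E D (λ w → E (draws f t G k) (λ ws → g (w ∷ ws)))
  E-draws-suc k g = trans (E-bind D _ g) (E-cong D (λ w → E-map _ (w ∷_) (λ _ _ → refl) (draws f t G k) g))

  draws-prob : IsProb D → ∀ k → IsProb (draws f t G k)
  draws-prob prob zero    = E-pure {List ℕ} [] (λ _ → 1ℚ)
  draws-prob prob (suc k) = trans (E-draws-suc k (λ _ → 1ℚ)) (trans (E-cong D (λ _ → draws-prob prob k)) prob)

module _ (f : ℕ → ℕ) (t : ℕ) (G : Graph) (e : ℕ → ℕ) where

  private
    D : Dist ℕ
    D = chooseEnd f t G

  total : List ℕ → ℚ
  total ws = fromℕ (sum (map e ws))

  μ₁ μ₂ : ℚ
  μ₁ = E D (λ w → fromℕ (e w))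
  μ₂ = E D (λ w → fromℕ (e w) * fromℕ (e w))

  module _ (prob : IsProb D) where

    private
      draws-prob′ : ∀ k → IsProb (draws f t G k)
      draws-prob′ = draws-prob f t G prob

      E-draws-suc-total : ∀ k (φ : ℚ → ℚ) →
        E (draws f t G (suc k)) (λ ws → φ (total ws)) ≡ E D (λ w → E (draws f t G k) (λ ws → φ (fromℕ (e w) + total ws)))
      E-draws-suc-total k φ = trans (E-draws-suc f t G k (λ ws → φ (total ws)))
        (E-cong D (λ w → E-cong (draws f t G k) (λ ws → cong φ (fromℕ-+ (e w) (sum (map e ws))))))

    draws-mean : ∀ k → E (draws f t G k) total ≡ fromℕ k * μ₁
    draws-mean zero    = trans (E-pure [] total) (trans fromℕ-0 (sym (trans (cong (_* μ₁) fromℕ-0) (ℚₚ.*-zeroˡ μ₁))))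
    draws-mean (suc k) = begin
      E (draws f t G (suc k)) total
        ≡⟨ E-draws-suc-total k (λ y → y) ⟩
      E D (λ w → E (draws f t G k) (λ ws → fromℕ (e w) + total ws))
        ≡⟨ E-cong D (λ w → trans (E-const-+ (draws f t G k) (draws-prob′ k) (fromℕ (e w)) total)
                                 (cong (fromℕ (e w) +_) (draws-mean k))) ⟩
      E D (λ w → fromℕ (e w) + fromℕ k * μ₁)
        ≡⟨ trans (E-+ D _ _) (cong (μ₁ +_) (E-const D prob _)) ⟩
      μ₁ + fromℕ k * μ₁
        ≡⟨ solve 2 (λ k m → m :+ k :* m := (con 1ℚ :+ k) :* m) refl (fromℕ k) μ₁ ⟩
      (1ℚ + fromℕ k) * μ₁
        ≡⟨ cong (_* μ₁) (fromℕ-suc k) ⟨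
      fromℕ (suc k) * μ₁ ∎
      where open ≡-Reasoning

    draws-second-moment : ∀ k →
      E (draws f t G k) (λ ws → total ws * total ws) ≡ fromℕ k * μ₂ + fromℕ k * (fromℕ k - 1ℚ) * μ₁ * μ₁
    draws-second-moment zero    = begin
      E (pureD []) (λ ws → total ws * total ws)
        ≡⟨ E-pure [] (λ ws → total ws * total ws) ⟩
      fromℕ 0 * fromℕ 0
        ≡⟨ cong (λ z → z * z) fromℕ-0 ⟩
      0ℚ * 0ℚ
        ≡⟨ solve 2 (λ a b → con 0ℚ :* con 0ℚ := con 0ℚ :* a :+ con 0ℚ :* (con 0ℚ :- con 1ℚ) :* b :* b) refl μ₂ μ₁ ⟩
      0ℚ * μ₂ + 0ℚ * (0ℚ - 1ℚ) * μ₁ * μ₁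
        ≡⟨ cong (λ z → z * μ₂ + z * (z - 1ℚ) * μ₁ * μ₁) fromℕ-0 ⟨
      fromℕ 0 * μ₂ + fromℕ 0 * (fromℕ 0 - 1ℚ) * μ₁ * μ₁ ∎
      where open ≡-Reasoning
    draws-second-moment (suc k) = begin
      E (draws f t G (suc k)) (λ ws → total ws * total ws)
        ≡⟨ E-draws-suc-total k (λ y → y * y) ⟩
      E D (λ w → E (draws f t G k) (λ ws → (fromℕ (e w) + total ws) * (fromℕ (e w) + total ws)))
        ≡⟨ E-cong D (λ w → trans (E-square-shift (draws f t G k) (draws-prob′ k) (fromℕ (e w)) total)
                                 (cong₂ (λ m v → fromℕ (e w) * fromℕ (e w) + (fromℕ (e w) + fromℕ (e w)) * m + v)
                                        (draws-mean k) (draws-second-moment k))) ⟩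
      E D (λ w → fromℕ (e w) * fromℕ (e w) + (fromℕ (e w) + fromℕ (e w)) * m + v)
        ≡⟨ trans (E-+ D _ _) (cong₂ _+_ (E-+ D _ _) (E-const D prob v)) ⟩
      μ₂ + E D (λ w → (fromℕ (e w) + fromℕ (e w)) * m) + v
        ≡⟨ cong (λ z → μ₂ + z + v) (trans (E-cong D (λ w → ℚₚ.*-comm (fromℕ (e w) + fromℕ (e w)) m))
                                          (trans (E-*ˡ D m (λ w → fromℕ (e w) + fromℕ (e w))) (cong (m *_) (E-+ D _ _)))) ⟩
      μ₂ + m * (μ₁ + μ₁) + v
        ≡⟨ solve 3 (λ k a b → b :+ k :* a :* (a :+ a) :+ (k :* b :+ k :* (k :- con 1ℚ) :* a :* a)
                           := (con 1ℚ :+ k) :* b :+ (con 1ℚ :+ k) :* ((con 1ℚ :+ k) :- con 1ℚ) :* a :* a)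
                   refl (fromℕ k) μ₁ μ₂ ⟩
      (1ℚ + fromℕ k) * μ₂ + (1ℚ + fromℕ k) * ((1ℚ + fromℕ k) - 1ℚ) * μ₁ * μ₁
        ≡⟨ cong (λ z → z * μ₂ + z * (z - 1ℚ) * μ₁ * μ₁) (fromℕ-suc k) ⟨
      fromℕ (suc k) * μ₂ + fromℕ (suc k) * (fromℕ (suc k) - 1ℚ) * μ₁ * μ₁ ∎
      where
      open ≡-Reasoning
      m = fromℕ k * μ₁
      v = fromℕ k * μ₂ + fromℕ k * (fromℕ k - 1ℚ) * μ₁ * μ₁

    E-draws-Ψ : ∀ x k → E (draws f t G k) (λ ws → Ψ (x + total ws))
      ≡ Ψ x + (x + x + 1ℚ) * (fromℕ k * μ₁) + (fromℕ k * μ₂ + fromℕ k * (fromℕ k - 1ℚ) * μ₁ * μ₁)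
    E-draws-Ψ x k = begin
      E (draws f t G k) (λ ws → Ψ (x + total ws))
        ≡⟨ E-+ (draws f t G k) _ _ ⟩
      E (draws f t G k) (λ ws → (x + total ws) * (x + total ws)) + E (draws f t G k) (λ ws → x + total ws)
        ≡⟨ cong₂ _+_ (E-square-shift (draws f t G k) (draws-prob′ k) x total)
                     (E-const-+ (draws f t G k) (draws-prob′ k) x total) ⟩
      x * x + (x + x) * E (draws f t G k) total + E (draws f t G k) (λ ws → total ws * total ws) + (x + E (draws f t G k) total)
        ≡⟨ cong₂ (λ m v → x * x + (x + x) * m + v + (x + m)) (draws-mean k) (draws-second-moment k) ⟩
      x * x + (x + x) * m + v + (x + m)
        ≡⟨ solve 3 (λ x m v → x :* x :+ (x :+ x) :* m :+ v :+ (x :+ m)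
                           := x :* x :+ x :+ (x :+ x :+ con 1ℚ) :* m :+ v) refl x m v ⟩
      Ψ x + (x + x + 1ℚ) * m + v ∎
      where
      open ≡-Reasoning
      m = fromℕ k * μ₁
      v = fromℕ k * μ₂ + fromℕ k * (fromℕ k - 1ℚ) * μ₁ * μ₁

module _ (f : ℕ → ℕ) where

  Admissible : ℕ → Graph → Set
  Admissible t G = EdgesWithin t G × length G ≡ F f t

  rate : ℕ → ℚ
  rate t = divℕ (f t) (2 ℕ.* F f t)

  rate-nonNeg : ∀ t → 0ℚ ≤ℚ rate t
  rate-nonNeg t = divℕ-nonNeg (f t) (2 ℕ.* F f t)

  module _ (t : ℕ) (G : Graph) where

    E-step : ∀ g → E (step f t G) g ≡ E (draws f t G (f t)) (λ ws → g (star (suc t) ws ++ G))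
    E-step = E-map _ (λ ws → star (suc t) ws ++ G) (λ _ _ → refl) (draws f t G (f t))

    step-supported : Admissible t G → Supported (Admissible (suc t)) (step f t G)
    step-supported (edges , |G|≡F) =
      Supported-map _ _ (λ _ _ → refl) grow (draws f t G (f t)) (draws-supported f t G (f t))
      where
      grow : ∀ ws → All (InRange t) ws × length ws ≡ f t → Admissible (suc t) (star (suc t) ws ++ G)
      grow ws (ws∈ , |ws|≡ft) =
        Allₚ.++⁺ (Allₚ.map⁺ (All.map new-edge ws∈)) (EdgesWithin-weaken G (ℕₚ.n≤1+n t) edges) , (begin
          length (star (suc t) ws ++ G)          ≡⟨ Listₚ.length-++ (star (suc t) ws) ⟩
          length (star (suc t) ws) ℕ.+ length G  ≡⟨ cong₂ ℕ._+_ (trans (length-star (suc t) ws) |ws|≡ft) |G|≡F ⟩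
          f t ℕ.+ F f t                          ≡⟨ ℕₚ.+-comm (f t) (F f t) ⟩
          F f (suc t)                            ∎)
        where
        open ≡-Reasoning
        new-edge : ∀ {w} → InRange t w → InRange (suc t) (suc t) × InRange (suc t) w
        new-edge (1≤w , w≤t) = (s≤s z≤n , ℕₚ.≤-refl) , (1≤w , ℕₚ.m≤n⇒m≤1+n w≤t)

    module _ (F≥1 : 1 ≤ F f t) (adm : Admissible t G) where

      private
        prob : IsProb (chooseEnd f t G)
        prob = chooseEnd-prob f t G F≥1 (proj₁ adm) (proj₂ adm)

        2F≥1 : 1 ≤ 2 ℕ.* F f t
        2F≥1 = ℕₚ.≤-trans F≥1 (ℕₚ.m≤m+n _ _)

      step-prob : IsProb (step f t G)
      step-prob = trans (E-step _) (draws-prob f t G prob (f t))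

      E-step-Ψ-newborn : E (step f t G) (λ H → Ψ (fromℕ (deg (suc t) H))) ≡ Ψ (fromℕ (f t))
      E-step-Ψ-newborn = begin
        E (step f t G) (λ H → Ψ (fromℕ (deg (suc t) H)))
          ≡⟨ E-step _ ⟩
        E (draws f t G (f t)) (λ ws → Ψ (fromℕ (deg (suc t) (star (suc t) ws ++ G))))
          ≡⟨ E-congOn (draws f t G (f t)) (draws-supported f t G (f t))
                      (λ ws ws∈ → cong (λ n → Ψ (fromℕ n)) (newborn-deg ws ws∈)) ⟩
        E (draws f t G (f t)) (λ _ → Ψ (fromℕ (f t)))
          ≡⟨ E-const (draws f t G (f t)) (draws-prob f t G prob (f t)) _ ⟩
        Ψ (fromℕ (f t)) ∎
        where
        open ≡-Reasoning
        newborn-deg : ∀ ws → All (InRange t) ws × length ws ≡ f t → deg (suc t) (star (suc t) ws ++ G) ≡ f t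
        newborn-deg ws (ws∈ , |ws|≡ft) rewrite deg-add-star (suc t) (suc t) ws G
                                             | deg-above G (proj₁ adm) (ℕₚ.n<1+n t) =
          trans (sum-star-newborn ws ws∈) |ws|≡ft

      module _ (u : ℕ) (t+1≢u : suc t ≢ u) where

        private
          x : ℚ
          x = fromℕ (deg u G)

          hit : ℕ → ℕ
          hit w = δ w u

          p : ℚ
          p = μ₁ f t G hit

          μ₂≡p : μ₂ f t G hit ≡ p
          μ₂≡p = E-cong (chooseEnd f t G) (λ w → trans (sym (fromℕ-* (hit w) (hit w))) (cong fromℕ (δ-*-δ w u)))

          p-nonNeg : 0ℚ ≤ℚ p
          p-nonNeg = E-nonNeg (chooseEnd f t G) (chooseEnd-supported f t G) (λ w → fromℕ-nonNeg (hit w))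

          p≤x/2F : p ≤ℚ x * divℕ 1 (2 ℕ.* F f t)
          p≤x/2F = ℚₚ.≤-trans (ℚₚ.≤-reflexive (E-chooseEnd f t G F≥1 hit))
            (ℚₚ.*-monoʳ-≤-nonNeg (divℕ 1 (2 ℕ.* F f t)) {{ℚ.nonNegative (divℕ-nonNeg 1 (2 ℕ.* F f t))}}
              (fromℕ-mono-≤ (sum-range-δ-≤ (λ v → deg v G) u t)))

          expected-hits-≤ : fromℕ (f t) * p ≤ℚ rate t * x
          expected-hits-≤ = begin
            fromℕ (f t) * p
              ≤⟨ ℚₚ.*-monoˡ-≤-nonNeg (fromℕ (f t)) {{ℚ.nonNegative (fromℕ-nonNeg (f t))}} p≤x/2F ⟩
            fromℕ (f t) * (x * divℕ 1 (2 ℕ.* F f t))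
              ≡⟨ solve 3 (λ k x r → k :* (x :* r) := k :* r :* x) refl (fromℕ (f t)) x _ ⟩
            fromℕ (f t) * divℕ 1 (2 ℕ.* F f t) * x
              ≡⟨ cong (_* x) (divℕ≡fromℕ-*-divℕ-1 (f t) (2 ℕ.* F f t) 2F≥1) ⟨
            rate t * x ∎
            where open ℚₚ.≤-Reasoning

          deg-after : ∀ ws → fromℕ (deg u (star (suc t) ws ++ G)) ≡ x + total f t G hit ws
          deg-after ws = trans (cong fromℕ (trans (deg-add-star u (suc t) ws G)
            (cong (λ n → deg u G ℕ.+ sum n) (Listₚ.map-cong (λ w → cong (ℕ._+ δ w u) (δ-≢ t+1≢u)) ws))))
            (fromℕ-+ (deg u G) _)

        E-step-Ψ-≤ : E (step f t G) (λ H → Ψ (fromℕ (deg u H))) ≤ℚ (1ℚ + rate t) * (1ℚ + rate t) * Ψ x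
        E-step-Ψ-≤ = begin
          E (step f t G) (λ H → Ψ (fromℕ (deg u H)))
            ≡⟨ trans (E-step _) (E-cong (draws f t G (f t)) (λ ws → cong Ψ (deg-after ws))) ⟩
          E (draws f t G (f t)) (λ ws → Ψ (x + total f t G hit ws))
            ≡⟨ E-draws-Ψ f t G hit prob x (f t) ⟩
          Ψ x + (x + x + 1ℚ) * (k * p) + (k * μ₂ f t G hit + k * (k - 1ℚ) * p * p)
            ≡⟨ cong (λ m → Ψ x + (x + x + 1ℚ) * (k * p) + (k * m + k * (k - 1ℚ) * p * p)) μ₂≡p ⟩
          Ψ x + (x + x + 1ℚ) * (k * p) + (k * p + k * (k - 1ℚ) * p * p)
            ≤⟨ Ψ-growth-≤ (fromℕ-nonNeg (deg u G)) (rate-nonNeg t) (fromℕ-nonNeg (f t)) p-nonNeg expected-hits-≤ ⟩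
          (1ℚ + rate t) * (1ℚ + rate t) * Ψ x ∎
          where
          open ℚₚ.≤-Reasoning
          k = fromℕ (f t)

  A≥1 : ∀ t → 1ℚ ≤ℚ A f t
  A≥1 t = prod≥1 (t ℕ.∸ 1)
    where
    prod≥1 : ∀ n → 1ℚ ≤ℚ prodℚ1 (λ j → 1ℚ + rate j) n
    prod≥1 zero    = ℚₚ.≤-refl
    prod≥1 (suc n) = 1≤-* (prod≥1 n) (≤-by-nonNeg-gap (rate (suc n)) refl (rate-nonNeg (suc n)))

  A-positive : ∀ t → ℚ.Positive (A f t)
  A-positive t = ℚ.positive (ℚₚ.<-≤-trans (ℚₚ.positive⁻¹ 1ℚ) (A≥1 t))

  A⁻¹ : ℕ → ℚ
  A⁻¹ t = (ℚ.1/ A f t) {{ℚₚ.pos⇒nonZero (A f t) {{A-positive t}}}}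

  A-*-A⁻¹ : ∀ t → A f t * A⁻¹ t ≡ 1ℚ
  A-*-A⁻¹ t = ℚₚ.*-inverseʳ (A f t) {{ℚₚ.pos⇒nonZero (A f t) {{A-positive t}}}}

  A⁻¹-nonNeg : ∀ t → 0ℚ ≤ℚ A⁻¹ t
  A⁻¹-nonNeg t = ℚₚ.nonNegative⁻¹ (A⁻¹ t)
    {{ℚₚ.pos⇒nonNeg (A⁻¹ t) {{ℚₚ.1/pos⇒pos (A f t) {{A-positive t}}}}}}

  A⁻¹≤1 : ∀ t → A⁻¹ t ≤ℚ 1ℚ
  A⁻¹≤1 t = subst₂ _≤ℚ_ (ℚₚ.*-identityʳ (A⁻¹ t)) (trans (ℚₚ.*-comm (A⁻¹ t) (A f t)) (A-*-A⁻¹ t))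
    (ℚₚ.*-monoˡ-≤-nonNeg (A⁻¹ t) {{ℚ.nonNegative (A⁻¹-nonNeg t)}} (A≥1 t))

  A⁻¹-suc : ∀ t → 1 ≤ t → A⁻¹ t ≡ (1ℚ + rate t) * A⁻¹ (suc t)
  A⁻¹-suc t@(suc _) _ = begin
    A⁻¹ t                                       ≡⟨ ℚₚ.*-identityʳ (A⁻¹ t) ⟨
    A⁻¹ t * 1ℚ                                  ≡⟨ cong (A⁻¹ t *_) (A-*-A⁻¹ (suc t)) ⟨
    A⁻¹ t * (A f t * g * A⁻¹ (suc t))           ≡⟨ solve 4 (λ a b g c → a :* (b :* g :* c) := (b :* a) :* (g :* c))
                                                           refl (A⁻¹ t) (A f t) g (A⁻¹ (suc t)) ⟩
    (A f t * A⁻¹ t) * (g * A⁻¹ (suc t))         ≡⟨ cong (_* (g * A⁻¹ (suc t))) (A-*-A⁻¹ t) ⟩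
    1ℚ * (g * A⁻¹ (suc t))                      ≡⟨ ℚₚ.*-identityˡ _ ⟩
    g * A⁻¹ (suc t)                             ∎
    where
    open ≡-Reasoning
    g = 1ℚ + rate t

  X≡ : ∀ u t G → X f u t G ≡ fromℕ (deg u G) * A⁻¹ t
  X≡ u t G with A f t ℚₚ.≟ 0ℚ
  ... | yes A≡0 = ⊥-elim (ℚₚ.<-irrefl (sym A≡0) (ℚₚ.positive⁻¹ (A f t) {{A-positive t}}))
  ... | no  _   = cong (_* A⁻¹ t) (sym (fromℕ-def (deg u G)))

  Φ : ℕ → ℕ → Graph → ℚ
  Φ u t G = A⁻¹ t * A⁻¹ t * Ψ (fromℕ (deg u G))

  A⁻¹²-nonNeg : ∀ t → 0ℚ ≤ℚ A⁻¹ t * A⁻¹ t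
  A⁻¹²-nonNeg t = *-nonNeg (A⁻¹-nonNeg t) (A⁻¹-nonNeg t)

  A⁻¹²≤1 : ∀ t → A⁻¹ t * A⁻¹ t ≤ℚ 1ℚ
  A⁻¹²≤1 t = ≤1-* (A⁻¹-nonNeg t) (A⁻¹≤1 t) (A⁻¹≤1 t)

  X²≤Φ : ∀ u t G → X f u t G * X f u t G ≤ℚ Φ u t G
  X²≤Φ u t G = subst (_≤ℚ Φ u t G) (sym (cong (λ y → y * y) (X≡ u t G)))
    (≤-by-nonNeg-gap (A⁻¹ t * A⁻¹ t * d)
      (solve 2 (λ a d → a :* a :* (d :* d :+ d) := d :* a :* (d :* a) :+ a :* a :* d) refl (A⁻¹ t) d)
      (*-nonNeg (A⁻¹²-nonNeg t) (fromℕ-nonNeg (deg u G))))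
    where d = fromℕ (deg u G)

  Φ≤Ψ : ∀ u t G → Φ u t G ≤ℚ Ψ (fromℕ (deg u G))
  Φ≤Ψ u t G = ≤-scaled-by-≤1 (A⁻¹²-nonNeg t) (A⁻¹²≤1 t) (Ψ-nonNeg (fromℕ-nonNeg (deg u G)))

  module _ {t G} (t≥1 : 1 ≤ t) (F≥1 : 1 ≤ F f t) (adm : Admissible t G) where

    Φ-supermartingale : ∀ u → suc t ≢ u → E (step f t G) (Φ u (suc t)) ≤ℚ Φ u t G
    Φ-supermartingale u t+1≢u = begin
      E (step f t G) (Φ u (suc t))
        ≡⟨ E-*ˡ (step f t G) c _ ⟩
      c * E (step f t G) (λ H → Ψ (fromℕ (deg u H)))
        ≤⟨ ℚₚ.*-monoˡ-≤-nonNeg c {{ℚ.nonNegative (A⁻¹²-nonNeg (suc t))}} (E-step-Ψ-≤ t G F≥1 adm u t+1≢u) ⟩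
      c * ((1ℚ + rate t) * (1ℚ + rate t) * Ψ (fromℕ (deg u G)))
        ≡⟨ solve 3 (λ a g y → a :* a :* (g :* g :* y) := (g :* a) :* (g :* a) :* y) refl (A⁻¹ (suc t)) (1ℚ + rate t) _ ⟩
      ((1ℚ + rate t) * A⁻¹ (suc t)) * ((1ℚ + rate t) * A⁻¹ (suc t)) * Ψ (fromℕ (deg u G))
        ≡⟨ cong (λ a → a * a * Ψ (fromℕ (deg u G))) (A⁻¹-suc t t≥1) ⟨
      Φ u t G ∎
      where
      open ℚₚ.≤-Reasoning
      c = A⁻¹ (suc t) * A⁻¹ (suc t)

    Φ-newborn : E (step f t G) (Φ (suc t) (suc t)) ≤ℚ Ψ (fromℕ (f t))
    Φ-newborn = begin
      E (step f t G) (Φ (suc t) (suc t))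
        ≡⟨ E-*ˡ (step f t G) c _ ⟩
      c * E (step f t G) (λ H → Ψ (fromℕ (deg (suc t) H)))
        ≡⟨ cong (c *_) (E-step-Ψ-newborn t G F≥1 adm) ⟩
      c * Ψ (fromℕ (f t))
        ≤⟨ ≤-scaled-by-≤1 (A⁻¹²-nonNeg (suc t)) (A⁻¹²≤1 (suc t)) (Ψ-nonNeg (fromℕ-nonNeg (f t))) ⟩
      Ψ (fromℕ (f t)) ∎
      where
      open ℚₚ.≤-Reasoning
      c = A⁻¹ (suc t) * A⁻¹ (suc t)

induction-from : ∀ (P : ℕ → Set) {m} → P m → (∀ t → m ≤ t → P t → P (suc t)) → ∀ t → m ≤ t → P t
induction-from P {m} base step t m≤t = subst P (ℕₚ.m∸n+n≡m m≤t) (go (t ℕ.∸ m))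
  where
  go : ∀ k → P (k ℕ.+ m)
  go zero    = base
  go (suc k) = step (k ℕ.+ m) (ℕₚ.m≤n+m m k) (go k)

module _ (f : ℕ → ℕ) (v' : ℕ) (G' : Graph) where

  MPA-initial : ∀ t → t ≤ v' → MPA f v' G' t ≡ pureD G'
  MPA-initial zero    _     = refl
  MPA-initial (suc t) t<v' with suc t ℕ.≤ᵇ v' | ℕₚ.≤⇒≤ᵇ t<v'
  ... | true | _ = refl

  MPA-suc : ∀ t → v' ≤ t → MPA f v' G' (suc t) ≡ bindD (MPA f v' G' t) (step f t)
  MPA-suc t v'≤t with suc t ℕ.≤ᵇ v' | ℕₚ.≤ᵇ⇒≤ (suc t) v'
  ... | true  | t<v' = ⊥-elim (ℕₚ.<-irrefl refl (ℕₚ.≤-trans (t<v' tt) v'≤t))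
  ... | false | _    = refl

  E-MPA-suc : ∀ t → v' ≤ t → ∀ g → E (MPA f v' G' (suc t)) g ≡ E (MPA f v' G' t) (λ G → E (step f t G) g)
  E-MPA-suc t v'≤t g = trans (cong (λ d → E d g) (MPA-suc t v'≤t)) (E-bind (MPA f v' G' t) (step f t) g)

  K : ℕ → ℚ
  K u = Ψ (fromℕ (deg u G')) + Ψ (fromℕ (f (u ℕ.∸ 1)))

  Ψ-deg≤K : ∀ u → Ψ (fromℕ (deg u G')) ≤ℚ K u
  Ψ-deg≤K u = ≤-by-nonNeg-gap (Ψ (fromℕ (f (u ℕ.∸ 1)))) refl (Ψ-nonNeg (fromℕ-nonNeg (f (u ℕ.∸ 1))))

  Ψ-birth≤K : ∀ u → Ψ (fromℕ (f (u ℕ.∸ 1))) ≤ℚ K u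
  Ψ-birth≤K u = ≤-by-nonNeg-gap (Ψ (fromℕ (deg u G')))
    (ℚₚ.+-comm (Ψ (fromℕ (deg u G'))) (Ψ (fromℕ (f (u ℕ.∸ 1))))) (Ψ-nonNeg (fromℕ-nonNeg (deg u G')))

  module _ (edges : EdgesWithin v' G') (f0≡|G'| : f 0 ≡ length G') (f0≥1 : 1 ≤ f 0)
           (silent : ∀ t → 1 ≤ t → t < v' → f t ≡ 0) (v'≥1 : 1 ≤ v') where

    F≥1 : ∀ t → 1 ≤ t → 1 ≤ F f t
    F≥1 (suc zero)    _ = f0≥1
    F≥1 (suc (suc t)) _ = ℕₚ.≤-trans (F≥1 (suc t) (s≤s z≤n)) (ℕₚ.m≤m+n _ _)

    F-initial : ∀ t → 1 ≤ t → t ≤ v' → F f t ≡ f 0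
    F-initial (suc zero)    _ _    = refl
    F-initial (suc (suc t)) _ t<v' = trans
      (cong₂ ℕ._+_ (F-initial (suc t) (s≤s z≤n) (ℕₚ.<⇒≤ t<v')) (silent (suc t) (s≤s z≤n) t<v'))
      (ℕₚ.+-identityʳ (f 0))

    private
      t≥1 : ∀ {t} → v' ≤ t → 1 ≤ t
      t≥1 v'≤t = ℕₚ.≤-trans v'≥1 v'≤t

    MPA-supported : ∀ t → v' ≤ t → Supported (Admissible f t) (MPA f v' G' t)
    MPA-supported = induction-from (λ t → Supported (Admissible f t) (MPA f v' G' t))
      (subst (Supported (Admissible f v')) (sym (MPA-initial v' ℕₚ.≤-refl))
             ((ℚₚ.nonNegative⁻¹ 1ℚ , (edges , trans (sym f0≡|G'|) (sym (F-initial v' v'≥1 ℕₚ.≤-refl)))) ∷ []))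
      (λ t v'≤t supp → subst (Supported (Admissible f (suc t))) (sym (MPA-suc t v'≤t))
        (Supported-bind (MPA f v' G' t) (step f t) supp (λ G adm → step-supported f t G adm)))

    MPA-prob : ∀ t → v' ≤ t → IsProb (MPA f v' G' t)
    MPA-prob = induction-from (λ t → IsProb (MPA f v' G' t))
      (trans (cong (λ d → E d (λ _ → 1ℚ)) (MPA-initial v' ℕₚ.≤-refl)) (E-pure G' (λ _ → 1ℚ)))
      (λ t v'≤t prob → begin
        E (MPA f v' G' (suc t)) (λ _ → 1ℚ)
          ≡⟨ E-MPA-suc t v'≤t (λ _ → 1ℚ) ⟩
        E (MPA f v' G' t) (λ G → E (step f t G) (λ _ → 1ℚ))
          ≡⟨ E-congOn (MPA f v' G' t) (MPA-supported t v'≤t) (λ G adm → step-prob f t G (F≥1 t (t≥1 v'≤t)) adm) ⟩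
        E (MPA f v' G' t) (λ _ → 1ℚ)
          ≡⟨ prob ⟩
        1ℚ ∎)
      where open ≡-Reasoning

    E-Φ-next-≤ : ∀ u t → v' ≤ t → E (MPA f v' G' t) (Φ f u t) ≤ℚ K u →
                 E (MPA f v' G' t) (λ G → E (step f t G) (Φ f u (suc t))) ≤ℚ K u
    E-Φ-next-≤ u t v'≤t IH with suc t ℕₚ.≟ u
    ... | no t+1≢u = ℚₚ.≤-trans
      (E-mono (MPA f v' G' t) (MPA-supported t v'≤t)
              (λ G adm → Φ-supermartingale f (t≥1 v'≤t) (F≥1 t (t≥1 v'≤t)) adm u t+1≢u))
      IH
    ... | yes refl = begin
      E (MPA f v' G' t) (λ G → E (step f t G) (Φ f (suc t) (suc t)))
        ≤⟨ E-mono (MPA f v' G' t) (MPA-supported t v'≤t) (λ G adm → Φ-newborn f (t≥1 v'≤t) (F≥1 t (t≥1 v'≤t)) adm) ⟩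
      E (MPA f v' G' t) (λ _ → Ψ (fromℕ (f t)))
        ≡⟨ E-const (MPA f v' G' t) (MPA-prob t v'≤t) (Ψ (fromℕ (f t))) ⟩
      Ψ (fromℕ (f t))
        ≤⟨ Ψ-birth≤K (suc t) ⟩
      K (suc t) ∎
      where open ℚₚ.≤-Reasoning

    E-Φ-≤ : ∀ u t → v' ≤ t → E (MPA f v' G' t) (Φ f u t) ≤ℚ K u
    E-Φ-≤ u = induction-from (λ t → E (MPA f v' G' t) (Φ f u t) ≤ℚ K u)
      (begin
        E (MPA f v' G' v') (Φ f u v')  ≡⟨ trans (cong (λ d → E d (Φ f u v')) (MPA-initial v' ℕₚ.≤-refl)) (E-pure G' (Φ f u v')) ⟩
        Φ f u v' G'                    ≤⟨ Φ≤Ψ f u v' G' ⟩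
        Ψ (fromℕ (deg u G'))           ≤⟨ Ψ-deg≤K u ⟩
        K u                            ∎)
      (λ t v'≤t IH → subst (_≤ℚ K u) (sym (E-MPA-suc t v'≤t (Φ f u (suc t)))) (E-Φ-next-≤ u t v'≤t IH))
      where open ℚₚ.≤-Reasoning

    E-X²-≤ : ∀ u t → E (MPA f v' G' t) (λ G → X f u t G * X f u t G) ≤ℚ K u
    E-X²-≤ u t with ℕₚ.≤-total t v'
    ... | inj₁ t≤v' = begin
      E (MPA f v' G' t) X²   ≡⟨ trans (cong (λ d → E d X²) (MPA-initial t t≤v')) (E-pure G' X²) ⟩
      X² G'                  ≤⟨ X²≤Φ f u t G' ⟩
      Φ f u t G'             ≤⟨ Φ≤Ψ f u t G' ⟩
      Ψ (fromℕ (deg u G'))   ≤⟨ Ψ-deg≤K u ⟩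
      K u                    ∎
      where
      open ℚₚ.≤-Reasoning
      X² : Graph → ℚ
      X² G = X f u t G * X f u t G
    ... | inj₂ v'≤t =
      ℚₚ.≤-trans (E-mono (MPA f v' G' t) (MPA-supported t v'≤t) (λ G _ → X²≤Φ f u t G)) (E-Φ-≤ u t v'≤t)

initial-nodes-positive : ∀ {v'} {f : ℕ → ℕ} G' →
  EdgesWithin v' G' → f 0 ≡ length G' → (∀ t → v' ≤ t → 1 ≤ f t) → 1 ≤ v'
initial-nodes-positive {suc _} _             _                         _     _      = s≤s z≤n
initial-nodes-positive {zero}  []            []                        f0≡0  active = subst (1 ≤_) f0≡0 (active 0 z≤n)
initial-nodes-positive {zero}  ((a , _) ∷ _) (((1≤a , a≤0) , _) ∷ _)  _     _      = ℕₚ.≤-trans 1≤a a≤0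

initial-edges-positive : ∀ {v'} G' → 1 ≤ v' → (∀ u → 1 ≤ u → u ≤ v' → 1 ≤ deg u G') → 1 ≤ length G'
initial-edges-positive []      v'≥1 deg≥1 = deg≥1 1 (s≤s z≤n) v'≥1
initial-edges-positive (_ ∷ _) _    _     = s≤s z≤n

corollary4p4 : (v' : ℕ) (G' : Graph) (f : ℕ → ℕ) →
    All (λ e → (1 ≤ Data.Product.proj₁ e × Data.Product.proj₁ e ≤ v')
             × (1 ≤ Data.Product.proj₂ e × Data.Product.proj₂ e ≤ v')) G' →
    All (λ e → Data.Product.proj₁ e ≢ Data.Product.proj₂ e) G' →
    (∀ u → 1 ≤ u → u ≤ v' → 1 ≤ deg u G') →
    f 0 ≡ length G' →
    (∀ t → 1 ≤ t → t < v' → f t ≡ 0) →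
    (∀ t → v' ≤ t → 1 ≤ f t) →
    (∃[ B ] (∀ n → sumℚ1 (λ s → divℕ (f s) (F f s) * divℕ (f s) (F f s)) n ≤ℚ B)) →
    (u : ℕ) →
    ∃[ C ] (∀ t → E (MPA f v' G' t) (λ G → X f u t G * X f u t G) ≤ℚ C)
corollary4p4 v' G' f edges _ deg≥1 f0≡|G'| silent active _ u =
  K f v' G' u , E-X²-≤ f v' G' edges f0≡|G'| f0≥1 silent v'≥1 u
  where
  v'≥1 : 1 ≤ v'
  v'≥1 = initial-nodes-positive G' edges f0≡|G'| active
  f0≥1 : 1 ≤ f 0
  f0≥1 = subst (1 ≤_) (sym f0≡|G'|) (initial-edges-positive G' v'≥1 deg≥1)
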